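{- Let $\alpha\in[0,1)$ be rational and let $G\in\mathfrak F_n$ (with respect to $\alpha$). Then the rank of $\hat W_\alpha(G)$ over $\mathbb F_2$ equals $\lfloor n/2\rfloor$.
   Context: All graphs are finite, simple and undirected; $G$ is connected (standing assumption). For a graph $G$ on $n$ vertices, $A(G)$ is its adjacency matrix, $D(G)$ its diagonal degree matrix, $A_\alpha(G)=\alpha D(G)+(1-\alpha)A(G)$. For rational $\alpha\in[0,1)$, $c_\alpha$ is the smallest positive integer such that $c_\alpha\alpha$ and $c_\alpha(1-\alpha)$ are integers, and $A_{c_\alpha}=A_{c_\alpha}(G)=c_\alpha A_\alpha(G)$. $\mathbf 1$ is the all-ones vector and $\tilde W_\alpha(G)=\left[\mathbf 1,\frac{A_{c_\alpha}\mathbf 1}{c_\alpha},\dots,\frac{A_{c_\alpha}^{n-1}\mathbf 1}{c_\alpha}\right]$ (an integral matrix). $\hat W_\alpha(G)=\left[\mathbf 1,\frac{A_{c_\alpha}\mathbf 1}{c_\alpha},\dots,\frac{A_{c_\alpha}^{n/2-1}\mathbf 1}{c_\alpha}\right]$ if $n$ is even, and $\hat W_\alpha(G)=\left[\frac{A_{c_\alpha}\mathbf 1}{c_\alpha},\frac{A_{c_\alpha}^2\mathbf 1}{c_\alpha},\dots,\frac{A_{c_\alpha}^{(n-1)/2}\mathbf 1}{c_\alpha}\right]$ if $n$ is odd. $\mathfrak F_n$ is the set of graphs $G$ on $n$ vertices such that $\frac{\det\tilde W_\alpha(G)}{2^{\lfloor n/2\rfloor}}$ is an odd square-free integer and $\tilde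 W_\alpha(G)$ has rank $n$ over $\mathbb F_p$ for each odd prime $p\mid c_\alpha$. -}

module Defs where

open import Data.Bool using (Bool; true; false; if_then_else_)
open import Data.Nat as ℕ using (ℕ; zero; suc)
open import Data.Nat.Primality using (Prime)
open import Data.Integer as ℤ using (ℤ; +_; -[1+_])
open import Data.Integer.DivMod using (_/ℕ_)
open import Data.Integer.Divisibility using (_∣_)
open import Data.Rational as ℚ using (ℚ; _/_)
open import Data.Fin using (Fin; zero; suc; punchIn; toℕ)
open import Data.Product using (Σ; ∃; _×_; _,_)
open import Relation.Nullary using (¬_)
open import Relation.Binary.PropositionalEquality using (_≡_; _≢_)
open import Function.Definitions using (Injective)

record Graph (n : ℕ) : Set where
  field
    adj       : Fin n → Fin n → Bool
    symmetric : ∀ i j → adj i j ≡ adj j i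
    loopless  : ∀ i → adj i i ≡ false
open Graph public

data Reachable {n : ℕ} (G : Graph n) : Fin n → Fin n → Set where
  here : ∀ {u} → Reachable G u u
  step : ∀ {u v w} → adj G u v ≡ true → Reachable G v w → Reachable G u w

Connected : ∀ {n} → Graph n → Set
Connected G = ∀ u v → Reachable G u v

sumℕ : ∀ {n} → (Fin n → ℕ) → ℕ
sumℕ {zero}  f = 0
sumℕ {suc n} f = f zero ℕ.+ sumℕ (λ i → f (suc i))

sumℤ : ∀ {n} → (Fin n → ℤ) → ℤ
sumℤ {zero}  f = + 0
sumℤ {suc n} f = f zero ℤ.+ sumℤ (λ i → f (suc i))

Matrix : ℕ → ℕ → Set
Matrix m k = Fin m → Fin k → ℤ

boolℕ : Bool → ℕ
boolℕ true  = 1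
boolℕ false = 0

deg : ∀ {n} → Graph n → Fin n → ℕ
deg G i = sumℕ (λ j → boolℕ (adj G i j))

adjMat : ∀ {n} → Graph n → Matrix n n
adjMat G i j = + boolℕ (adj G i j)

degMat : ∀ {n} → Graph n → Matrix n n
degMat {n} G i j with Data.Fin._≟_ i j
... | Relation.Nullary.yes _ = + deg G i
... | Relation.Nullary.no _  = + 0

InUnit : ℚ → Set
InUnit α = (ℚ.0ℚ ℚ.≤ α) × (α ℚ.< ℚ.1ℚ)

IsIntegerℚ : ℚ → Set
IsIntegerℚ q = Σ ℤ λ z → q ≡ z / 1

Clears : ℚ → ℕ → Set
Clears α c = IsIntegerℚ ((+ c / 1) ℚ.* α) × IsIntegerℚ ((+ c / 1) ℚ.* (ℚ.1ℚ ℚ.- α))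

IsCAlpha : ℚ → ℕ → Set
IsCAlpha α c = (0 ℕ.< c) × Clears α c × (∀ c' → 0 ℕ.< c' → Clears α c' → c ℕ.≤ c')

-- A_{c_α}(G) = (c_α α) D(G) + (c_α (1-α)) A(G), where a = c_α α and b = c_α (1-α).
Ac : ∀ {n} → ℤ → ℤ → Graph n → Matrix n n
Ac a b G i j = (a ℤ.* degMat G i j) ℤ.+ (b ℤ.* adjMat G i j)

matVec : ∀ {n} → Matrix n n → (Fin n → ℤ) → (Fin n → ℤ)
matVec M v i = sumℤ (λ j → M i j ℤ.* v j)

matPowVec : ∀ {n} → Matrix n n → ℕ → (Fin n → ℤ) → (Fin n → ℤ)
matPowVec M zero    v = v
matPowVec M (suc k) v = matVec M (matPowVec M k v)

ones : ∀ {n} → Fin n → ℤ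
ones _ = + 1

-- Integer division by c (c > 0 in all uses; the value for c = 0 is irrelevant).
divBy : ℤ → ℕ → ℤ
divBy z zero    = + 0
divBy z (suc c) = z /ℕ suc c

Wcol : ∀ {n} → ℕ → ℤ → ℤ → Graph n → ℕ → Fin n → ℤ
Wcol c a b G zero    i = + 1
Wcol c a b G (suc k) i = divBy (matPowVec (Ac a b G) (suc k) ones i) c

Wtilde : ∀ {n} → ℕ → ℤ → ℤ → Graph n → Matrix n n
Wtilde c a b G i j = Wcol c a b G (toℕ j) i

isEven : ℕ → Bool
isEven zero          = true
isEven (suc zero)    = false
isEven (suc (suc n)) = isEven n

Whatt : ∀ {n} → ℕ → ℤ → ℤ → Graph n → Matrix n (n ℕ./ 2)
Whatt {n} c a b G i j =
  if isEven n then Wcol c a b G (toℕ j) i else Wcol c a b G (suc (toℕ j)) i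

sign : ℕ → ℤ
sign zero          = + 1
sign (suc zero)    = -[1+ 0 ]
sign (suc (suc k)) = sign k

det : ∀ {n} → Matrix n n → ℤ
det {zero}  M = + 1
det {suc n} M = sumℤ (λ j → sign (toℕ j) ℤ.* (M zero j ℤ.* det (λ r s → M (suc r) (punchIn j s))))

Odd : ℤ → Set
Odd z = ¬ (+ 2 ∣ z)

SquareFree : ℤ → Set
SquareFree z = ∀ p → Prime p → ¬ ((+ p ℤ.* + p) ∣ z)

IndepCols : ∀ {m k r} → ℕ → Matrix m k → (Fin r → Fin k) → Set
IndepCols {m} {k} {r} p M σ =
  (coef : Fin r → ℤ) → (∀ i → + p ∣ sumℤ (λ j → coef j ℤ.* M i (σ j))) → ∀ j → + p ∣ coef j

HasRank : ∀ {m k} → ℕ → Matrix m k → ℕ → Set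
HasRank {m} {k} p M r =
  (Σ (Fin r → Fin k) λ σ → Injective _≡_ _≡_ σ × IndepCols p M σ) ×
  (∀ (σ : Fin (suc r) → Fin k) → Injective _≡_ _≡_ σ → ¬ IndepCols p M σ)

InF : ∀ {n} → ℕ → ℤ → ℤ → Graph n → Set
InF {n} c a b G =
  (Σ ℤ λ q → (det (Wtilde c a b G) ≡ (+ (2 ℕ.^ (n ℕ./ 2))) ℤ.* q) × Odd q × SquareFree q) ×
  (∀ p → Prime p → Odd (+ p) → + p ∣ + c → HasRank p (Wtilde c a b G) n)

-- The columns of W̃ are w₀ = 𝟏 and wₖ = A_c^k 𝟏 / c, so A_c w₀ = c w₁ and A_c wₖ = wₖ₊₁ for k ≥ 1. A relation
-- Σ f_K w_K ≡ 0 (mod 2) whose highest odd coefficient sits at index T is therefore carried by A_c to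
-- relations with top index T + 1, T + 2, …: every column from T on is, modulo 2, a combination of earlier
-- columns, and halving these columns one at a time gives 2^(n - T) ∣ det W̃ (T = 0 is impossible, w₀ = 𝟏
-- being odd). The columns of Ŵ are w_E, …, w_(E+h-1) with h = ⌊n/2⌋ and n = E + 2h, so a mod-2 dependency
-- among them would give 2^(h+1) ∣ det W̃ = 2^h · odd. Thus Ŵ has h independent columns over 𝔽₂, and it
-- has only h columns.

module Submission where

open import Defs
open import Data.Nat using (ℕ; _/_)
open import Data.Integer using (ℤ; +_)
open import Data.Rational using (ℚ; 1ℚ) renaming (_/_ to _/ℚ_; _*_ to _*ℚ_; _-_ to _-ℚ_)
open import Relation.Binary.PropositionalEquality using (_≡_)

open import Data.Bool using (true; false; if_then_else_)
open import Data.Empty using (⊥-elim)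
open import Data.Fin using (Fin; zero; suc; toℕ; punchIn; punchOut)
import Data.Fin as Fin
import Data.Fin.Properties as Fin
open import Data.Integer using (-_; _+_; _-_; _*_)
import Data.Integer as ℤ
open import Data.Integer.DivMod using (_/ℕ_; _%ℕ_; [n/ℕd]*d≤n; n<s[n/ℕd]*d; a≡a%ℕn+[a/ℕn]*n; n%ℕd<d)
open import Data.Integer.Divisibility.Signed using (_∣_; divides)
import Data.Integer.Divisibility.Signed as ∣
import Data.Integer.GCD as ℤ
import Data.Integer.Properties as ℤ
open import Data.Integer.Tactic.RingSolver using (solve-∀)
open import Data.Nat using (zero; suc)
import Data.Nat as ℕ
import Data.Nat.DivMod as ℕ
import Data.Nat.Divisibility as ℕ∣
import Data.Nat.Properties as ℕ
open import Data.Nat.Tactic.RingSolver using () renaming (solve-∀ to ℕ-solve-∀)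
open import Data.Product using (∃; _×_; _,_; proj₁; proj₂)
open import Data.Rational using (↥_; ↧_) renaming (_+_ to _+ℚ_)
import Data.Rational.Properties as ℚ
open import Data.Rational.Solver using () renaming (module +-*-Solver to ℚ-Solver)
open import Data.Sum using (_⊎_; inj₁; inj₂)
open import Function using (id; _∘_; case_of_)
open import Relation.Binary.Definitions using (tri<; tri≈; tri>)
open import Relation.Binary.PropositionalEquality
  using (_≢_; refl; sym; trans; cong; cong₂; subst; subst₂; module ≡-Reasoning)
open import Relation.Nullary using (¬_; Dec; yes; no; ¬?)
open import Relation.Nullary.Decidable using (decidable-stable)
open import Relation.Unary using (Decidable)

open import Algebra.Properties.AbelianGroup ℤ.+-0-abelianGroup using (inverseʳ-unique)
open import Algebra.Properties.CommutativeSemigroup ℤ.+-commutativeSemigroup using (interchange)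

open ≡-Reasoning

Even : ℤ → Set
Even x = + 2 ∣ x

Even-0 : Even (+ 0)
Even-0 = divides (+ 0) refl

1∣ : ∀ x → + 1 ∣ x
1∣ x = divides x (sym (ℤ.*-identityʳ x))

sumℤ-cong : ∀ {n} {f g : Fin n → ℤ} → (∀ k → f k ≡ g k) → sumℤ f ≡ sumℤ g
sumℤ-cong {zero}  f≗g = refl
sumℤ-cong {suc n} f≗g = cong₂ _+_ (f≗g zero) (sumℤ-cong (f≗g ∘ suc))

sumℤ-+ : ∀ {n} (f g : Fin n → ℤ) → sumℤ (λ k → f k + g k) ≡ sumℤ f + sumℤ g
sumℤ-+ {zero}  f g = refl
sumℤ-+ {suc n} f g = begin
  (f zero + g zero) + sumℤ (λ k → f (suc k) + g (suc k))
    ≡⟨ cong (_+_ (f zero + g zero)) (sumℤ-+ (f ∘ suc) (g ∘ suc)) ⟩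
  (f zero + g zero) + (sumℤ (f ∘ suc) + sumℤ (g ∘ suc))
    ≡⟨ interchange (f zero) (g zero) _ _ ⟩
  (f zero + sumℤ (f ∘ suc)) + (g zero + sumℤ (g ∘ suc)) ∎

sumℤ-scale : ∀ {n} x (f : Fin n → ℤ) → sumℤ (λ k → x * f k) ≡ x * sumℤ f
sumℤ-scale {zero}  x f = sym (ℤ.*-zeroʳ x)
sumℤ-scale {suc n} x f = begin
  x * f zero + sumℤ (λ k → x * f (suc k)) ≡⟨ cong (_+_ (x * f zero)) (sumℤ-scale x (f ∘ suc)) ⟩
  x * f zero + x * sumℤ (f ∘ suc)         ≡⟨ ℤ.*-distribˡ-+ x (f zero) _ ⟨
  x * (f zero + sumℤ (f ∘ suc))           ∎

sumℤ-linear : ∀ {n} l m (f g : Fin n → ℤ) →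
              sumℤ (λ k → l * f k + m * g k) ≡ l * sumℤ f + m * sumℤ g
sumℤ-linear l m f g =
  trans (sumℤ-+ (λ k → l * f k) (λ k → m * g k)) (cong₂ _+_ (sumℤ-scale l f) (sumℤ-scale m g))

sumℤ-neg : ∀ {n} (f : Fin n → ℤ) → sumℤ (λ k → - f k) ≡ - sumℤ f
sumℤ-neg {zero}  f = refl
sumℤ-neg {suc n} f =
  trans (cong (_+_ (- f zero)) (sumℤ-neg (f ∘ suc))) (sym (ℤ.neg-distrib-+ (f zero) _))

sumℤ-pos : ∀ {n} (f : Fin n → ℕ) → sumℤ (λ k → + f k) ≡ + sumℕ f
sumℤ-pos {zero}  f = refl
sumℤ-pos {suc n} f =
  trans (cong (_+_ (+ f zero)) (sumℤ-pos (f ∘ suc))) (sym (ℤ.pos-+ (f zero) _))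

sumℤ-zero : ∀ {n} (f : Fin n → ℤ) → (∀ k → f k ≡ + 0) → sumℤ f ≡ + 0
sumℤ-zero {zero}  f f≗0 = refl
sumℤ-zero {suc n} f f≗0 = cong₂ _+_ (f≗0 zero) (sumℤ-zero (f ∘ suc) (f≗0 ∘ suc))

sumℤ-single : ∀ {n} (f : Fin n → ℤ) p → (∀ k → k ≢ p → f k ≡ + 0) → sumℤ f ≡ f p
sumℤ-single f zero    f≗0 = begin
  f zero + sumℤ (f ∘ suc) ≡⟨ cong (_+_ (f zero)) (sumℤ-zero (f ∘ suc) λ k → f≗0 (suc k) λ ()) ⟩
  f zero + + 0            ≡⟨ ℤ.+-identityʳ (f zero) ⟩
  f zero                  ∎
sumℤ-single f (suc p) f≗0 = begin
  f zero + sumℤ (f ∘ suc)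
    ≡⟨ cong₂ _+_ (f≗0 zero λ ()) (sumℤ-single (f ∘ suc) p λ k k≢p → f≗0 (suc k) (k≢p ∘ Fin.suc-injective)) ⟩
  + 0 + f (suc p)
    ≡⟨ ℤ.+-identityˡ (f (suc p)) ⟩
  f (suc p) ∎

sumℤ-pair : ∀ {n} (f : Fin n → ℤ) p q → p ≢ q → (∀ k → k ≢ p → k ≢ q → f k ≡ + 0) →
            sumℤ f ≡ f p + f q
sumℤ-pair f zero    zero    p≢q f≗0 = ⊥-elim (p≢q refl)
sumℤ-pair f zero    (suc q) p≢q f≗0 =
  cong (_+_ (f zero)) (sumℤ-single (f ∘ suc) q λ k k≢q → f≗0 (suc k) (λ ()) (k≢q ∘ Fin.suc-injective))
sumℤ-pair f (suc p) zero    p≢q f≗0 = begin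
  f zero + sumℤ (f ∘ suc)
    ≡⟨ cong (_+_ (f zero)) (sumℤ-single (f ∘ suc) p λ k k≢p → f≗0 (suc k) (k≢p ∘ Fin.suc-injective) (λ ())) ⟩
  f zero + f (suc p)
    ≡⟨ ℤ.+-comm (f zero) (f (suc p)) ⟩
  f (suc p) + f zero ∎
sumℤ-pair f (suc p) (suc q) p≢q f≗0 = begin
  f zero + sumℤ (f ∘ suc)
    ≡⟨ cong₂ _+_ (f≗0 zero (λ ()) (λ ()))
         (sumℤ-pair (f ∘ suc) p q (p≢q ∘ cong suc)
           λ k k≢p k≢q → f≗0 (suc k) (k≢p ∘ Fin.suc-injective) (k≢q ∘ Fin.suc-injective)) ⟩
  + 0 + (f (suc p) + f (suc q))
    ≡⟨ ℤ.+-identityˡ _ ⟩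
  f (suc p) + f (suc q) ∎

sumℤ-even : ∀ {n} (f : Fin n → ℤ) → (∀ k → Even (f k)) → Even (sumℤ f)
sumℤ-even {zero}  f even = Even-0
sumℤ-even {suc n} f even = ∣.∣m∣n⇒∣m+n (even zero) (sumℤ-even (f ∘ suc) (even ∘ suc))

sumTo : ℕ → (ℕ → ℤ) → ℤ
sumTo N F = sumℤ {N} (F ∘ toℕ)

sumTo-cong : ∀ N {F G : ℕ → ℤ} → (∀ K → K ℕ.< N → F K ≡ G K) → sumTo N F ≡ sumTo N G
sumTo-cong N F≗G = sumℤ-cong λ k → F≗G (toℕ k) (Fin.toℕ<n k)

sumTo-snoc : ∀ N F → sumTo (suc N) F ≡ sumTo N F + F N
sumTo-snoc zero    F = trans (ℤ.+-identityʳ (F 0)) (sym (ℤ.+-identityˡ (F 0)))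
sumTo-snoc (suc N) F = begin
  F 0 + sumTo (suc N) (F ∘ suc)         ≡⟨ cong (_+_ (F 0)) (sumTo-snoc N (F ∘ suc)) ⟩
  F 0 + (sumTo N (F ∘ suc) + F (suc N)) ≡⟨ ℤ.+-assoc (F 0) _ _ ⟨
  F 0 + sumTo N (F ∘ suc) + F (suc N)   ∎

sumTo-vanishing-tail : ∀ {N} m F → m ℕ.≤ N → (∀ K → m ℕ.≤ K → F K ≡ + 0) →
                       sumTo N F ≡ sumTo m F
sumTo-vanishing-tail {N}     zero    F _ F≗0 = sumℤ-zero {N} (F ∘ toℕ) λ k → F≗0 (toℕ k) ℕ.z≤n
sumTo-vanishing-tail {suc N} (suc m) F (ℕ.s≤s m≤N) F≗0 =
  cong (_+_ (F 0)) (sumTo-vanishing-tail m (F ∘ suc) m≤N (λ K m≤K → F≗0 (suc K) (ℕ.s≤s m≤K)))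

-- Determinants

toℕ≤toℕ-punchIn : ∀ {n} (k : Fin (suc n)) s → toℕ s ℕ.≤ toℕ (punchIn k s)
toℕ≤toℕ-punchIn zero    s       = ℕ.n≤1+n (toℕ s)
toℕ≤toℕ-punchIn (suc k) zero    = ℕ.z≤n
toℕ≤toℕ-punchIn (suc k) (suc s) = ℕ.s≤s (toℕ≤toℕ-punchIn k s)

Adjacent : ∀ {n} → Fin n → Fin n → Set
Adjacent p q = toℕ q ≡ suc (toℕ p)

adjacent⇒≢ : ∀ {n} {p q : Fin n} → Adjacent p q → p ≢ q
adjacent⇒≢ p~q refl = ℕ.1+n≢n (sym p~q)

punchIn-reflects-adjacent : ∀ {n} (k : Fin (suc n)) s t →
                            Adjacent (punchIn k s) (punchIn k t) → Adjacent s t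
punchIn-reflects-adjacent zero    s       t       s~t = ℕ.suc-injective s~t
punchIn-reflects-adjacent (suc k) zero    (suc t) s~t =
  cong suc (ℕ.n≤0⇒n≡0 (subst (toℕ t ℕ.≤_) (ℕ.suc-injective s~t) (toℕ≤toℕ-punchIn k t)))
punchIn-reflects-adjacent (suc k) (suc s) (suc t) s~t =
  cong suc (punchIn-reflects-adjacent k s t (ℕ.suc-injective s~t))

punchIn-adjacent : ∀ {n} {p q : Fin (suc n)} → Adjacent p q → ∀ s →
                   punchIn p s ≡ punchIn q s ⊎ (punchIn p s ≡ q × punchIn q s ≡ p)
punchIn-adjacent {p = zero}  {suc zero} p~q zero    = inj₂ (refl , refl)
punchIn-adjacent {p = zero}  {suc zero} p~q (suc s) = inj₁ refl
punchIn-adjacent {p = suc p} {suc q}    p~q zero    = inj₁ refl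
punchIn-adjacent {p = suc p} {suc q}    p~q (suc s) with punchIn-adjacent (ℕ.suc-injective p~q) s
... | inj₁ same         = inj₁ (cong suc same)
... | inj₂ (p↦q , q↦p) = inj₂ (cong suc p↦q , cong suc q↦p)

punchIn≡⇒≡punchOut : ∀ {n} {k m : Fin (suc n)} (k≢m : k ≢ m) s → punchIn k s ≡ m → s ≡ punchOut k≢m
punchIn≡⇒≡punchOut {k = k} k≢m s eq =
  Fin.punchIn-injective k s (punchOut k≢m) (trans eq (sym (Fin.punchIn-punchOut k≢m)))

column : ∀ {m k} → Matrix m k → Fin k → Fin m → ℤ
column M s r = M r s

setColumn : ∀ {n} → Matrix n n → Fin n → (Fin n → ℤ) → Matrix n n
setColumn M m v r s with s Fin.≟ m
... | yes _ = v r
... | no  _ = M r s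

setColumn-≡ : ∀ {n} (M : Matrix n n) m v r → setColumn M m v r m ≡ v r
setColumn-≡ M m v r with m Fin.≟ m
... | yes _   = refl
... | no  m≢m = ⊥-elim (m≢m refl)

setColumn-≢ : ∀ {n} (M : Matrix n n) m v r s → s ≢ m → setColumn M m v r s ≡ M r s
setColumn-≢ M m v r s s≢m with s Fin.≟ m
... | yes s≡m = ⊥-elim (s≢m s≡m)
... | no  _   = refl

setColumn-≢-irrelevant : ∀ {n} (M : Matrix n n) m v v′ r s → s ≢ m →
                         setColumn M m v r s ≡ setColumn M m v′ r s
setColumn-≢-irrelevant M m v v′ r s s≢m =
  trans (setColumn-≢ M m v r s s≢m) (sym (setColumn-≢ M m v′ r s s≢m))

minor : ∀ {n} → Matrix (suc n) (suc n) → Fin (suc n) → Matrix n n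
minor M k r s = M (suc r) (punchIn k s)

laplaceTerm : ∀ {n} → Matrix (suc n) (suc n) → Fin (suc n) → ℤ
laplaceTerm M k = sign (toℕ k) * (M zero k * det (minor M k))

det-cong : ∀ {n} {M N : Matrix n n} → (∀ r s → M r s ≡ N r s) → det M ≡ det N
det-cong {zero}  M≈N = refl
det-cong {suc n} M≈N = sumℤ-cong λ k →
  cong₂ (λ x d → sign (toℕ k) * (x * d)) (M≈N zero k) (det-cong λ r s → M≈N (suc r) (punchIn k s))

det-linear : ∀ {n} (M N P : Matrix n n) m l μ →
             (∀ r s → s ≢ m → N r s ≡ M r s) → (∀ r s → s ≢ m → P r s ≡ M r s) →
             (∀ r → M r m ≡ l * N r m + μ * P r m) → det M ≡ l * det N + μ * det P
det-linear {zero}  M N P () l μ N≈M P≈M Mₘ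
det-linear {suc n} M N P m l μ N≈M P≈M Mₘ = begin
  sumℤ (laplaceTerm M)                                   ≡⟨ sumℤ-cong term-linear ⟩
  sumℤ (λ k → l * laplaceTerm N k + μ * laplaceTerm P k) ≡⟨ sumℤ-linear l μ (laplaceTerm N) (laplaceTerm P) ⟩
  l * det N + μ * det P                                  ∎
  where
  term-linear : ∀ k → laplaceTerm M k ≡ l * laplaceTerm N k + μ * laplaceTerm P k
  term-linear k with k Fin.≟ m
  ... | yes refl = begin
    σ * (M zero k * d)                                  ≡⟨ cong (λ x → σ * (x * d)) (Mₘ zero) ⟩
    σ * ((l * N zero k + μ * P zero k) * d)             ≡⟨ distrib σ l μ (N zero k) (P zero k) d ⟩
    l * (σ * (N zero k * d)) + μ * (σ * (P zero k * d))
      ≡⟨ cong₂ (λ dₙ dₚ → l * (σ * (N zero k * dₙ)) + μ * (σ * (P zero k * dₚ)))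
           (det-cong λ r s → sym (N≈M (suc r) (punchIn k s) (Fin.punchInᵢ≢i k s)))
           (det-cong λ r s → sym (P≈M (suc r) (punchIn k s) (Fin.punchInᵢ≢i k s))) ⟩
    l * laplaceTerm N k + μ * laplaceTerm P k           ∎
    where
    σ = sign (toℕ k)
    d = det (minor M k)
    distrib : ∀ σ l μ x y d → σ * ((l * x + μ * y) * d) ≡ l * (σ * (x * d)) + μ * (σ * (y * d))
    distrib = solve-∀
  ... | no k≢m = begin
    σ * (M zero k * det (minor M k))
      ≡⟨ cong (λ d → σ * (M zero k * d)) minor-linear ⟩
    σ * (M zero k * (l * det (minor N k) + μ * det (minor P k)))
      ≡⟨ distrib σ (M zero k) l μ _ _ ⟩
    l * (σ * (M zero k * det (minor N k))) + μ * (σ * (M zero k * det (minor P k)))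
      ≡⟨ cong₂ (λ x y → l * (σ * (x * det (minor N k))) + μ * (σ * (y * det (minor P k))))
           (sym (N≈M zero k k≢m)) (sym (P≈M zero k k≢m)) ⟩
    l * laplaceTerm N k + μ * laplaceTerm P k ∎
    where
    σ = sign (toℕ k)
    distrib : ∀ σ x l μ d e → σ * (x * (l * d + μ * e)) ≡ l * (σ * (x * d)) + μ * (σ * (x * e))
    distrib = solve-∀
    m′ = punchOut k≢m
    off : ∀ {X : Matrix (suc n) (suc n)} → (∀ r s → s ≢ m → X r s ≡ M r s) →
          ∀ r s → s ≢ m′ → minor X k r s ≡ minor M k r s
    off X≈M r s s≢m′ = X≈M (suc r) (punchIn k s) (s≢m′ ∘ punchIn≡⇒≡punchOut k≢m s)
    minor-linear : det (minor M k) ≡ l * det (minor N k) + μ * det (minor P k)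
    minor-linear = det-linear (minor M k) (minor N k) (minor P k) m′ l μ (off N≈M) (off P≈M) λ r →
      subst (λ s → M (suc r) s ≡ l * N (suc r) s + μ * P (suc r) s)
            (sym (Fin.punchIn-punchOut k≢m)) (Mₘ (suc r))

det-additive : ∀ {n} (M N P : Matrix n n) m →
               (∀ r s → s ≢ m → N r s ≡ M r s) → (∀ r s → s ≢ m → P r s ≡ M r s) →
               (∀ r → M r m ≡ N r m + P r m) → det M ≡ det N + det P
det-additive M N P m N≈M P≈M Mₘ = begin
  det M                     ≡⟨ det-linear M N P m (+ 1) (+ 1) N≈M P≈M Mₘ′ ⟩
  + 1 * det N + + 1 * det P ≡⟨ 1*-both (det N) (det P) ⟩
  det N + det P             ∎
  where
  1*-both : ∀ x y → + 1 * x + + 1 * y ≡ x + y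
  1*-both x y = cong₂ _+_ (ℤ.*-identityˡ x) (ℤ.*-identityˡ y)
  Mₘ′ : ∀ r → M r m ≡ + 1 * N r m + + 1 * P r m
  Mₘ′ r = trans (Mₘ r) (sym (1*-both (N r m) (P r m)))

sign-suc : ∀ k → sign (suc k) ≡ - sign k
sign-suc zero          = refl
sign-suc (suc zero)    = refl
sign-suc (suc (suc k)) = sign-suc k

-- In the first-row expansion only the terms at p and q survive (the other minors still have two equal
-- adjacent columns); their minors coincide and their signs are opposite.
det-adjacent-equal-columns : ∀ {n} (M : Matrix n n) {p q : Fin n} → Adjacent p q →
                             (∀ r → M r p ≡ M r q) → det M ≡ + 0
det-adjacent-equal-columns {zero}  M {()}
det-adjacent-equal-columns {suc n} M {p} {q} p~q Mₚ≡M_q = begin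
  sumℤ (laplaceTerm M)
    ≡⟨ sumℤ-pair (laplaceTerm M) p q (adjacent⇒≢ p~q) other-terms-vanish ⟩
  σ * (M zero p * det (minor M p)) + sign (toℕ q) * (M zero q * det (minor M q))
    ≡⟨ cong₂ (λ σ′ x → σ * (M zero p * det (minor M p)) + σ′ * (x * det (minor M q)))
         (trans (cong sign p~q) (sign-suc (toℕ p))) (sym (Mₚ≡M_q zero)) ⟩
  σ * (M zero p * det (minor M p)) + - σ * (M zero p * det (minor M q))
    ≡⟨ cong (λ d → σ * (M zero p * det (minor M p)) + - σ * (M zero p * d)) (sym equal-minors) ⟩
  σ * (M zero p * det (minor M p)) + - σ * (M zero p * det (minor M p))
    ≡⟨ cancel σ _ ⟩
  + 0 ∎
  where
  σ = sign (toℕ p)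
  cancel : ∀ σ t → σ * t + - σ * t ≡ + 0
  cancel = solve-∀
  equal-minors : det (minor M p) ≡ det (minor M q)
  equal-minors = det-cong λ r s → case punchIn-adjacent p~q s of λ where
    (inj₁ same)         → cong (M (suc r)) same
    (inj₂ (p↦q , q↦p)) →
      trans (cong (M (suc r)) p↦q) (trans (sym (Mₚ≡M_q (suc r))) (cong (M (suc r)) (sym q↦p)))
  other-terms-vanish : ∀ k → k ≢ p → k ≢ q → laplaceTerm M k ≡ + 0
  other-terms-vanish k k≢p k≢q = begin
    sign (toℕ k) * (M zero k * det (minor M k)) ≡⟨ cong (λ d → sign (toℕ k) * (M zero k * d)) minor-vanishes ⟩
    sign (toℕ k) * (M zero k * + 0)             ≡⟨ cong (sign (toℕ k) *_) (ℤ.*-zeroʳ (M zero k)) ⟩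
    sign (toℕ k) * + 0                          ≡⟨ ℤ.*-zeroʳ (sign (toℕ k)) ⟩
    + 0                                         ∎
    where
    minor-vanishes : det (minor M k) ≡ + 0
    minor-vanishes = det-adjacent-equal-columns (minor M k) {punchOut k≢p} {punchOut k≢q}
      (punchIn-reflects-adjacent k _ _
        (subst₂ Adjacent (sym (Fin.punchIn-punchOut k≢p)) (sym (Fin.punchIn-punchOut k≢q)) p~q))
      λ r → trans (cong (M (suc r)) (Fin.punchIn-punchOut k≢p))
              (trans (Mₚ≡M_q (suc r)) (cong (M (suc r)) (sym (Fin.punchIn-punchOut k≢q))))

module _ {n} (M : Matrix n n) {p q : Fin n} (p~q : Adjacent p q) where

  private
    p≢q : p ≢ q
    p≢q = adjacent⇒≢ p~q

  withColumns : (Fin n → ℤ) → (Fin n → ℤ) → Matrix n n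
  withColumns x y = setColumn (setColumn M p x) q y

  withColumns-p : ∀ x y r → withColumns x y r p ≡ x r
  withColumns-p x y r = trans (setColumn-≢ (setColumn M p x) q y r p p≢q) (setColumn-≡ M p x r)

  withColumns-q : ∀ x y r → withColumns x y r q ≡ y r
  withColumns-q x y r = setColumn-≡ (setColumn M p x) q y r

  withColumns-off : ∀ x y r s → s ≢ p → s ≢ q → withColumns x y r s ≡ M r s
  withColumns-off x y r s s≢p s≢q =
    trans (setColumn-≢ (setColumn M p x) q y r s s≢q) (setColumn-≢ M p x r s s≢p)

  private
    ignoresˡ : ∀ x x′ y r s → s ≢ p → withColumns x′ y r s ≡ withColumns x y r s
    ignoresˡ x x′ y r s s≢p with s Fin.≟ q
    ... | yes _ = refl
    ... | no  _ = setColumn-≢-irrelevant M p x′ x r s s≢p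

    ignoresʳ : ∀ x y y′ r s → s ≢ q → withColumns x y′ r s ≡ withColumns x y r s
    ignoresʳ x y y′ = setColumn-≢-irrelevant (setColumn M p x) q y′ y

    additiveˡ : ∀ x x′ y →
                det (withColumns (λ r → x r + x′ r) y) ≡ det (withColumns x y) + det (withColumns x′ y)
    additiveˡ x x′ y = det-additive _ _ _ p (ignoresˡ _ x y) (ignoresˡ _ x′ y) λ r →
      trans (withColumns-p _ y r) (sym (cong₂ _+_ (withColumns-p x y r) (withColumns-p x′ y r)))

    additiveʳ : ∀ x y y′ →
                det (withColumns x (λ r → y r + y′ r)) ≡ det (withColumns x y) + det (withColumns x y′)
    additiveʳ x y y′ = det-additive _ _ _ q (ignoresʳ x _ y) (ignoresʳ x _ y′) λ r →
      trans (withColumns-q x _ r) (sym (cong₂ _+_ (withColumns-q x y r) (withColumns-q x y′ r)))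

    repeated : ∀ x → det (withColumns x x) ≡ + 0
    repeated x = det-adjacent-equal-columns (withColumns x x) p~q λ r →
      trans (withColumns-p x x r) (sym (withColumns-q x x r))

    unchanged : det (withColumns (column M p) (column M q)) ≡ det M
    unchanged = det-cong λ r s → entry r s (s Fin.≟ p) (s Fin.≟ q)
      where
      entry : ∀ r s → Dec (s ≡ p) → Dec (s ≡ q) → withColumns (column M p) (column M q) r s ≡ M r s
      entry r s (yes s≡p) _ =
        trans (cong (withColumns _ _ r) s≡p) (trans (withColumns-p _ _ r) (cong (M r) (sym s≡p)))
      entry r s (no _) (yes s≡q) =
        trans (cong (withColumns _ _ r) s≡q) (trans (withColumns-q _ _ r) (cong (M r) (sym s≡q)))
      entry r s (no s≢p) (no s≢q) = withColumns-off _ _ r s s≢p s≢q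

  -- Expand det (B w w) = 0, with w = u + v, by additivity in both columns.
  det-swap-adjacent : det (withColumns (column M q) (column M p)) ≡ - det M
  det-swap-adjacent = inverseʳ-unique (det M) _ (begin
    det M + det (B v u)
      ≡⟨ cong₂ _+_ (sym (trans (cong (_+ det (B u v)) (repeated u)) (trans (ℤ.+-identityˡ _) unchanged)))
                   (sym (trans (cong (_+_ (det (B v u))) (repeated v)) (ℤ.+-identityʳ _))) ⟩
    (det (B u u) + det (B u v)) + (det (B v u) + det (B v v))
      ≡⟨ sym (cong₂ _+_ (additiveʳ u u v) (additiveʳ v u v)) ⟩
    det (B u w) + det (B v w)
      ≡⟨ sym (additiveˡ u v w) ⟩
    det (B w w)
      ≡⟨ repeated w ⟩
    + 0 ∎)
    where
    B = withColumns
    u = column M p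
    v = column M q
    w = λ r → u r + v r

-- Moving the equal column j next to i by an adjacent swap reduces the distance d.
det-equal-columns-apart : ∀ {n} d (M : Matrix n n) {i j : Fin n} → toℕ j ≡ suc (toℕ i ℕ.+ d) →
                          (∀ r → M r i ≡ M r j) → det M ≡ + 0
det-equal-columns-apart zero    M {i} j≡i+1 Mᵢ≡Mⱼ =
  det-adjacent-equal-columns M (trans j≡i+1 (cong suc (ℕ.+-identityʳ (toℕ i)))) Mᵢ≡Mⱼ
det-equal-columns-apart {n} (suc d) M {i} {j} j≡i+d+2 Mᵢ≡Mⱼ = begin
  det M                                               ≡⟨ ℤ.neg-involutive (det M) ⟨
  - - det M                                           ≡⟨ cong -_ (det-swap-adjacent M p~j) ⟨
  - det (withColumns M p~j (column M j) (column M p)) ≡⟨ cong -_ (det-equal-columns-apart d _ p≡i+d+1 swapped) ⟩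
  + 0                                                 ∎
  where
  j≡i+d+2′ : toℕ j ≡ suc (suc (toℕ i ℕ.+ d))
  j≡i+d+2′ = trans j≡i+d+2 (cong suc (ℕ.+-suc (toℕ i) d))
  p<n : suc (toℕ i ℕ.+ d) ℕ.< n
  p<n = ℕ.<-trans (ℕ.n<1+n _) (subst (ℕ._< n) j≡i+d+2′ (Fin.toℕ<n j))
  p = Fin.fromℕ< p<n
  p≡i+d+1 : toℕ p ≡ suc (toℕ i ℕ.+ d)
  p≡i+d+1 = Fin.toℕ-fromℕ< p<n
  p~j : Adjacent p j
  p~j = trans j≡i+d+2′ (cong suc (sym p≡i+d+1))
  i<p : toℕ i ℕ.< toℕ p
  i<p = subst (toℕ i ℕ.<_) (sym p≡i+d+1) (ℕ.s≤s (ℕ.m≤m+n (toℕ i) d))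
  i<j : toℕ i ℕ.< toℕ j
  i<j = ℕ.<-trans i<p (subst (toℕ p ℕ.<_) (sym p~j) (ℕ.n<1+n (toℕ p)))
  swapped : ∀ r → withColumns M p~j (column M j) (column M p) r i
                  ≡ withColumns M p~j (column M j) (column M p) r p
  swapped r = begin
    withColumns M p~j _ _ r i ≡⟨ withColumns-off M p~j _ _ r i (ℕ.<⇒≢ i<p ∘ cong toℕ) (ℕ.<⇒≢ i<j ∘ cong toℕ) ⟩
    M r i                     ≡⟨ Mᵢ≡Mⱼ r ⟩
    M r j                     ≡⟨ withColumns-p M p~j _ _ r ⟨
    withColumns M p~j _ _ r p ∎

det-equal-columns : ∀ {n} (M : Matrix n n) {i j : Fin n} → i ≢ j → (∀ r → M r i ≡ M r j) → det M ≡ + 0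
det-equal-columns M {i} {j} i≢j Mᵢ≡Mⱼ with ℕ.<-cmp (toℕ i) (toℕ j)
... | tri< i<j _ _ =
  det-equal-columns-apart (toℕ j ℕ.∸ suc (toℕ i)) M (sym (ℕ.m+[n∸m]≡n i<j)) Mᵢ≡Mⱼ
... | tri≈ _ i≡j _ = ⊥-elim (i≢j (Fin.toℕ-injective i≡j))
... | tri> _ _ j<i =
  det-equal-columns-apart (toℕ i ℕ.∸ suc (toℕ j)) M (sym (ℕ.m+[n∸m]≡n j<i)) (sym ∘ Mᵢ≡Mⱼ)

det-zero-column : ∀ {n} (M : Matrix n n) m → det (setColumn M m (λ _ → + 0)) ≡ + 0
det-zero-column M m = det-linear _ M M m (+ 0) (+ 0) unchanged unchanged (setColumn-≡ M m _)
  where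
  unchanged : ∀ r s → s ≢ m → M r s ≡ setColumn M m (λ _ → + 0) r s
  unchanged r s s≢m = sym (setColumn-≢ M m _ r s s≢m)

det-setColumn-sum : ∀ {n ℓ} (M : Matrix n n) m (g : Fin ℓ → ℤ) (F : Fin ℓ → Fin n → ℤ) →
                    det (setColumn M m (λ r → sumℤ (λ k → g k * F k r)))
                    ≡ sumℤ (λ k → g k * det (setColumn M m (F k)))
det-setColumn-sum {ℓ = zero}  M m g F = det-zero-column M m
det-setColumn-sum {ℓ = suc ℓ} M m g F = begin
  det (setColumn M m (λ r → g zero * F zero r + rest r))
    ≡⟨ det-linear _ _ _ m (g zero) (+ 1) (setColumn-≢-irrelevant M m _ _) (setColumn-≢-irrelevant M m _ _) split ⟩
  g zero * det (setColumn M m (F zero)) + + 1 * det (setColumn M m rest)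
    ≡⟨ cong (_+_ (g zero * det (setColumn M m (F zero)))) (ℤ.*-identityˡ _) ⟩
  g zero * det (setColumn M m (F zero)) + det (setColumn M m rest)
    ≡⟨ cong (_+_ (g zero * det (setColumn M m (F zero)))) (det-setColumn-sum M m (g ∘ suc) (F ∘ suc)) ⟩
  sumℤ (λ k → g k * det (setColumn M m (F k))) ∎
  where
  rest : Fin _ → ℤ
  rest r = sumℤ (λ k → g (suc k) * F (suc k) r)
  split : ∀ r → setColumn M m (λ r → g zero * F zero r + rest r) r m
                ≡ g zero * setColumn M m (F zero) r m + + 1 * setColumn M m rest r m
  split r = begin
    setColumn M m _ r m
      ≡⟨ setColumn-≡ M m _ r ⟩
    g zero * F zero r + rest r
      ≡⟨ cong (_+_ (g zero * F zero r)) (ℤ.*-identityˡ (rest r)) ⟨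
    g zero * F zero r + + 1 * rest r
      ≡⟨ cong₂ (λ x y → g zero * x + + 1 * y) (setColumn-≡ M m (F zero) r) (setColumn-≡ M m rest r) ⟨
    g zero * setColumn M m (F zero) r m + + 1 * setColumn M m rest r m ∎

det-setColumn-columns : ∀ {n} (M : Matrix n n) m (g : Fin n → ℤ) → g m ≡ + 0 →
                        det (setColumn M m (λ r → sumℤ (λ k → g k * M r k))) ≡ + 0
det-setColumn-columns M m g gₘ≡0 =
  trans (det-setColumn-sum M m g (column M)) (sumℤ-zero _ term-vanishes)
  where
  term-vanishes : ∀ k → g k * det (setColumn M m (column M k)) ≡ + 0
  term-vanishes k with k Fin.≟ m
  ... | yes refl = cong (_* det (setColumn M m (column M k))) gₘ≡0
  ... | no  k≢m  = trans (cong (g k *_) (det-equal-columns _ k≢m λ r →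
                     trans (setColumn-≢ M m _ r k k≢m) (sym (setColumn-≡ M m (column M k) r))))
                     (ℤ.*-zeroʳ (g k))

-- Columns that are even modulo earlier columns

record DependsMod2OnEarlier {n} (M : Matrix n n) (m : Fin n) : Set where
  field
    half          : Fin n → ℤ
    coefficient   : Fin n → ℤ
    earlier-only  : ∀ k → toℕ m ℕ.≤ toℕ k → coefficient k ≡ + 0
    decomposition : ∀ r → M r m ≡ + 2 * half r + sumℤ (λ k → coefficient k * M r k)

module _ {n} {M : Matrix n n} {m : Fin n} (dep : DependsMod2OnEarlier M m) where
  open DependsMod2OnEarlier dep

  det-halve : det M ≡ + 2 * det (setColumn M m half)
  det-halve = begin
    det M
      ≡⟨ det-linear M _ _ m (+ 2) (+ 1) (setColumn-≢ M m half) (setColumn-≢ M m earlier) column-m ⟩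
    + 2 * det (setColumn M m half) + + 1 * det (setColumn M m earlier)
      ≡⟨ cong (λ d → + 2 * det (setColumn M m half) + + 1 * d)
           (det-setColumn-columns M m coefficient (earlier-only m ℕ.≤-refl)) ⟩
    + 2 * det (setColumn M m half) + + 0
      ≡⟨ ℤ.+-identityʳ _ ⟩
    + 2 * det (setColumn M m half) ∎
    where
    earlier : Fin n → ℤ
    earlier r = sumℤ (λ k → coefficient k * M r k)
    column-m : ∀ r → M r m ≡ + 2 * setColumn M m half r m + + 1 * setColumn M m earlier r m
    column-m r = begin
      M r m
        ≡⟨ decomposition r ⟩
      + 2 * half r + earlier r
        ≡⟨ cong (_+_ (+ 2 * half r)) (ℤ.*-identityˡ (earlier r)) ⟨
      + 2 * half r + + 1 * earlier r
        ≡⟨ cong₂ (λ x y → + 2 * x + + 1 * y) (setColumn-≡ M m half r) (setColumn-≡ M m earlier r) ⟨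
      + 2 * setColumn M m half r m + + 1 * setColumn M m earlier r m ∎

  setColumn-later-preserves : ∀ {m′} v → toℕ m ℕ.< toℕ m′ → DependsMod2OnEarlier (setColumn M m′ v) m
  setColumn-later-preserves {m′} v m<m′ = record
    { half          = half
    ; coefficient   = coefficient
    ; earlier-only  = earlier-only
    ; decomposition = λ r → begin
        setColumn M m′ v r m                                             ≡⟨ setColumn-≢ M m′ v r m m≢m′ ⟩
        M r m                                                            ≡⟨ decomposition r ⟩
        + 2 * half r + sumℤ (λ k → coefficient k * M r k)                ≡⟨ cong (_+_ (+ 2 * half r))
                                                                              (sumℤ-cong (same-terms r)) ⟩
        + 2 * half r + sumℤ (λ k → coefficient k * setColumn M m′ v r k) ∎
    }
    where
    m≢m′ : m ≢ m′
    m≢m′ = ℕ.<⇒≢ m<m′ ∘ cong toℕ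
    same-terms : ∀ r k → coefficient k * M r k ≡ coefficient k * setColumn M m′ v r k
    same-terms r k = case k Fin.≟ m′ of λ where
      (yes refl) → let c≡0 = earlier-only k (ℕ.<⇒≤ m<m′) in
                   trans (cong (_* M r k) c≡0) (sym (cong (_* setColumn M m′ v r k) c≡0))
      (no k≢m′)  → cong (coefficient k *_) (sym (setColumn-≢ M m′ v r k k≢m′))

-- Halve the top column of the window [lo, lo + j); the columns below it keep their dependencies.
2^∣det : ∀ {n} j lo (M : Matrix n n) → lo ℕ.+ j ℕ.≤ n →
         (∀ m → lo ℕ.≤ toℕ m → toℕ m ℕ.< lo ℕ.+ j → DependsMod2OnEarlier M m) → + (2 ℕ.^ j) ∣ det M
2^∣det zero    lo M _ _ = 1∣ (det M)
2^∣det {n} (suc j) lo M lo+j<n dep =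
  subst₂ _∣_ (sym (ℤ.pos-* 2 (2 ℕ.^ j))) (sym (det-halve dep-top))
    (∣.*-monoʳ-∣ (+ 2) (2^∣det j lo M′ (ℕ.<⇒≤ top<n) dep′))
  where
  top<n : lo ℕ.+ j ℕ.< n
  top<n = subst (ℕ._≤ n) (ℕ.+-suc lo j) lo+j<n
  top = Fin.fromℕ< top<n
  top≡lo+j : toℕ top ≡ lo ℕ.+ j
  top≡lo+j = Fin.toℕ-fromℕ< top<n
  lo+j<lo+j+1 : lo ℕ.+ j ℕ.< lo ℕ.+ suc j
  lo+j<lo+j+1 = ℕ.+-monoʳ-< lo (ℕ.n<1+n j)
  dep-top : DependsMod2OnEarlier M top
  dep-top = dep top (subst (lo ℕ.≤_) (sym top≡lo+j) (ℕ.m≤m+n lo j))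
                    (subst (ℕ._< lo ℕ.+ suc j) (sym top≡lo+j) lo+j<lo+j+1)
  M′ = setColumn M top (DependsMod2OnEarlier.half dep-top)
  dep′ : ∀ m → lo ℕ.≤ toℕ m → toℕ m ℕ.< lo ℕ.+ j → DependsMod2OnEarlier M′ m
  dep′ m lo≤m m<lo+j = setColumn-later-preserves (dep m lo≤m (ℕ.<-trans m<lo+j lo+j<lo+j+1)) _
                         (subst (toℕ m ℕ.<_) (sym top≡lo+j) m<lo+j)

2^∣det-from : ∀ {n} lo (M : Matrix n n) → (∀ m → lo ℕ.≤ toℕ m → DependsMod2OnEarlier M m) →
              + (2 ℕ.^ (n ℕ.∸ lo)) ∣ det M
2^∣det-from {n} lo M dep with lo ℕ.≤? n
... | yes lo≤n = 2^∣det (n ℕ.∸ lo) lo M (ℕ.≤-reflexive (ℕ.m+[n∸m]≡n lo≤n)) (λ m lo≤m _ → dep m lo≤m)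
... | no  lo≰n = subst (λ e → + (2 ℕ.^ e) ∣ det M) (sym (ℕ.m≤n⇒m∸n≡0 (ℕ.≰⇒≥ lo≰n))) (1∣ (det M))

¬Even⇒Even-pred : ∀ x → ¬ Even x → Even (x - + 1)
¬Even⇒Even-pred x odd with x %ℕ 2 | a≡a%ℕn+[a/ℕn]*n x 2 | n%ℕd<d x 2
... | zero        | x≡ | _ = ⊥-elim (odd (divides (x /ℕ 2) (trans x≡ (ℤ.+-identityˡ _))))
... | suc (suc _) | _  | ℕ.s≤s (ℕ.s≤s ())
... | suc zero    | x≡ | _ = divides (x /ℕ 2) (trans (cong (_- + 1) x≡) (cancel (x /ℕ 2)))
  where
  cancel : ∀ q → (+ 1 + q * + 2) - + 1 ≡ q * + 2
  cancel = solve-∀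

¬Even1 : ¬ Even (+ 1)
¬Even1 2∣1 with ℕ∣.∣1⇒≡1 (∣.∣⇒∣ᵤ 2∣1)
... | ()

2^-mono-∣ : ∀ {m k} → m ℕ.≤ k → + (2 ℕ.^ m) ∣ + (2 ℕ.^ k)
2^-mono-∣ {m} {k} m≤k = ∣.∣ᵤ⇒∣ (ℕ∣.divides (2 ℕ.^ (k ℕ.∸ m)) (begin
  2 ℕ.^ k                      ≡⟨ cong (2 ℕ.^_) (ℕ.m∸n+n≡m m≤k) ⟨
  2 ℕ.^ (k ℕ.∸ m ℕ.+ m)        ≡⟨ ℕ.^-distribˡ-+-* 2 (k ℕ.∸ m) m ⟩
  2 ℕ.^ (k ℕ.∸ m) ℕ.* 2 ℕ.^ m  ∎))

2^[1+h]∣2^h*q⇒Even : ∀ h q → + (2 ℕ.^ suc h) ∣ + (2 ℕ.^ h) * q → Even q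
2^[1+h]∣2^h*q⇒Even h q 2^[1+h]∣ = ∣.*-cancelˡ-∣ (+ (2 ℕ.^ h)) {{ℕ.m^n≢0 2 h}}
  (subst (_∣ + (2 ℕ.^ h) * q) 2^[1+h]≡2^h*2 2^[1+h]∣)
  where
  2^[1+h]≡2^h*2 : + (2 ℕ.^ suc h) ≡ + (2 ℕ.^ h) * + 2
  2^[1+h]≡2^h*2 = trans (cong +_ (ℕ.*-comm 2 (2 ℕ.^ h))) (ℤ.pos-* (2 ℕ.^ h) 2)

1+h≤n∸[E+t] : ∀ {n h} E {t} → n ≡ E ℕ.+ 2 ℕ.* h → t ℕ.< h → suc h ℕ.≤ n ℕ.∸ (E ℕ.+ t)
1+h≤n∸[E+t] {n} {h} E {t} n≡E+2h t<h = ℕ.m+n≤o⇒m≤o∸n (suc h)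
  (subst₂ ℕ._≤_ (sym (rearrange h E t)) E+2h≡n (ℕ.+-monoʳ-≤ E (ℕ.+-monoʳ-≤ h t<h)))
  where
  E+2h≡n : E ℕ.+ (h ℕ.+ h) ≡ n
  E+2h≡n = trans (cong (λ x → E ℕ.+ (h ℕ.+ x)) (sym (ℕ.+-identityʳ h))) (sym n≡E+2h)
  rearrange : ∀ h E t → suc h ℕ.+ (E ℕ.+ t) ≡ E ℕ.+ (h ℕ.+ suc t)
  rearrange = ℕ-solve-∀

restrict : ℕ → (ℕ → ℤ) → ℕ → ℤ
restrict zero    f K       = + 0
restrict (suc T) f zero    = f 0
restrict (suc T) f (suc K) = restrict T (f ∘ suc) K

restrict-< : ∀ T f K → K ℕ.< T → restrict T f K ≡ f K
restrict-< (suc T) f zero    _           = refl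
restrict-< (suc T) f (suc K) (ℕ.s≤s K<T) = restrict-< T (f ∘ suc) K K<T

restrict-≥ : ∀ T f K → T ℕ.≤ K → restrict T f K ≡ + 0
restrict-≥ zero    f K       _           = refl
restrict-≥ (suc T) f (suc K) (ℕ.s≤s T≤K) = restrict-≥ T (f ∘ suc) K T≤K

δ : ℕ → ℕ → ℤ
δ zero    zero    = + 1
δ zero    (suc K) = + 0
δ (suc T) zero    = + 0
δ (suc T) (suc K) = δ T K

δ-≡ : ∀ T → δ T T ≡ + 1
δ-≡ zero    = refl
δ-≡ (suc T) = δ-≡ T

δ-≢ : ∀ T K → T ≢ K → δ T K ≡ + 0
δ-≢ zero    zero    T≢K = ⊥-elim (T≢K refl)
δ-≢ zero    (suc K) _   = refl
δ-≢ (suc T) zero    _   = refl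
δ-≢ (suc T) (suc K) T≢K = δ-≢ T K (T≢K ∘ cong suc)

normalise : ℕ → (ℕ → ℤ) → ℕ → ℤ
normalise T f K = restrict T f K + δ T K

normalise-< : ∀ T f K → K ℕ.< T → normalise T f K ≡ f K
normalise-< T f K K<T =
  trans (cong₂ _+_ (restrict-< T f K K<T) (δ-≢ T K (ℕ.>⇒≢ K<T))) (ℤ.+-identityʳ (f K))

normalise-≡ : ∀ T f → normalise T f T ≡ + 1
normalise-≡ T f = trans (cong₂ _+_ (restrict-≥ T f T ℕ.≤-refl) (δ-≡ T)) (ℤ.+-identityˡ (+ 1))

normalise-> : ∀ T f K → T ℕ.< K → normalise T f K ≡ + 0
normalise-> T f K T<K = cong₂ _+_ (restrict-≥ T f K (ℕ.<⇒≤ T<K)) (δ-≢ T K (ℕ.<⇒≢ T<K))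

normalise-even-difference : ∀ T f → ¬ Even (f T) → (∀ K → T ℕ.< K → Even (f K)) →
                            ∀ K → Even (f K - normalise T f K)
normalise-even-difference T f odd even-above K with ℕ.<-cmp K T
... | tri< K<T _ _  = subst Even (sym (trans (cong (_-_ (f K)) (normalise-< T f K K<T)) (ℤ.+-inverseʳ (f K))))
                       Even-0
... | tri≈ _ refl _ = subst Even (cong (_-_ (f K)) (sym (normalise-≡ T f))) (¬Even⇒Even-pred (f K) odd)
... | tri> _ _ T<K  = subst Even (sym (trans (cong (_-_ (f K)) (normalise-> T f K T<K)) (ℤ.+-identityʳ (f K))))
                       (even-above K T<K)

extend : ∀ {h} → (Fin h → ℤ) → ℕ → ℤ
extend {zero}  f K       = + 0
extend {suc h} f zero    = f zero
extend {suc h} f (suc K) = extend (f ∘ suc) K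

extend-toℕ : ∀ {h} (f : Fin h → ℤ) j → extend f (toℕ j) ≡ f j
extend-toℕ f zero    = refl
extend-toℕ f (suc j) = extend-toℕ (f ∘ suc) j

extend-≥ : ∀ {h} (f : Fin h → ℤ) K → h ℕ.≤ K → extend f K ≡ + 0
extend-≥ {zero}  f K       _          = refl
extend-≥ {suc h} f (suc K) (ℕ.s≤s h≤K) = extend-≥ (f ∘ suc) K h≤K

padLeft : ℕ → (ℕ → ℤ) → ℕ → ℤ
padLeft zero    f K       = f K
padLeft (suc E) f zero    = + 0
padLeft (suc E) f (suc K) = padLeft E f K

padLeft-≥ : ∀ E f K → E ℕ.≤ K → padLeft E f K ≡ f (K ℕ.∸ E)
padLeft-≥ zero    f K       _          = refl
padLeft-≥ (suc E) f (suc K) (ℕ.s≤s E≤K) = padLeft-≥ E f K E≤K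

sumTo-padLeft : ∀ E h f (x : ℕ → ℤ) →
                sumTo (E ℕ.+ h) (λ K → padLeft E f K * x K) ≡ sumTo h (λ k → f k * x (E ℕ.+ k))
sumTo-padLeft zero    h f x = refl
sumTo-padLeft (suc E) h f x = trans (ℤ.+-identityˡ _) (sumTo-padLeft E h f (x ∘ suc))

last-satisfying : ∀ (P : ℕ → Set) → Decidable P → ∀ {h j} → j ℕ.< h → P j →
                  ∃ λ t → t ℕ.< h × P t × (∀ K → t ℕ.< K → K ℕ.< h → ¬ P K)
last-satisfying P P? {suc h} j<1+h Pj with P? h
... | yes Ph = h , ℕ.n<1+n h , Ph , λ K h<K K<1+h → ⊥-elim (ℕ.<⇒≱ h<K (ℕ.s≤s⁻¹ K<1+h))
... | no ¬Ph with ℕ.m≤n⇒m<n∨m≡n (ℕ.s≤s⁻¹ j<1+h)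
...   | inj₂ refl = ⊥-elim (¬Ph Pj)
...   | inj₁ j<h with last-satisfying P P? j<h Pj
...     | t , t<h , Pt , none-after = t , ℕ.m<n⇒m<1+n t<h , Pt , none-after′
  where
  none-after′ : ∀ K → t ℕ.< K → K ℕ.< suc h → ¬ P K
  none-after′ K t<K K<1+h with ℕ.m≤n⇒m<n∨m≡n (ℕ.s≤s⁻¹ K<1+h)
  ... | inj₁ K<h  = none-after K t<K K<h
  ... | inj₂ refl = ¬Ph

-- The walk matrix

divBy-exact : ∀ c′ {x y} → x ≡ + suc c′ * y → divBy x (suc c′) ≡ y
divBy-exact c′ {x} {y} x≡cy = ℤ.≤-antisym q≤y y≤q
  where
  c = suc c′
  q = x /ℕ c
  x≡yc : x ≡ y * + c
  x≡yc = trans x≡cy (ℤ.*-comm (+ c) y)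
  q≤y : q ℤ.≤ y
  q≤y = ℤ.*-cancelʳ-≤-pos q y (+ c) (subst (q * + c ℤ.≤_) x≡yc ([n/ℕd]*d≤n x c))
  y<q+1 : y ℤ.< ℤ.suc q
  y<q+1 = ℤ.*-cancelʳ-<-nonNeg (+ c) (subst (ℤ._< ℤ.suc q * + c) x≡yc (n<s[n/ℕd]*d x c))
  y≤q : y ℤ.≤ q
  y≤q = subst (y ℤ.≤_) (ℤ.pred-suc q) (ℤ.i<j⇒i≤pred[j] y<q+1)

matVec-cong : ∀ {n} (M : Matrix n n) {u v : Fin n → ℤ} → (∀ j → u j ≡ v j) →
              ∀ i → matVec M u i ≡ matVec M v i
matVec-cong M u≗v i = sumℤ-cong λ j → cong (M i j *_) (u≗v j)

matVec-scale : ∀ {n} (M : Matrix n n) x (u : Fin n → ℤ) i →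
               matVec M (λ j → x * u j) i ≡ x * matVec M u i
matVec-scale M x u i =
  trans (sumℤ-cong λ j → commute (M i j) x (u j)) (sumℤ-scale x λ j → M i j * u j)
  where
  commute : ∀ m x u → m * (x * u) ≡ x * (m * u)
  commute = solve-∀

matVec-sumTo : ∀ {n} (M : Matrix n n) N (f : ℕ → ℤ) (x : ℕ → Fin n → ℤ) i →
               matVec M (λ j → sumTo N (λ K → f K * x K j)) i ≡ sumTo N (λ K → f K * matVec M (x K) i)
matVec-sumTo M zero    f x i = sumℤ-zero _ λ j → ℤ.*-zeroʳ (M i j)
matVec-sumTo M (suc N) f x i = begin
  sumℤ (λ j → M i j * (f 0 * x 0 j + rest j))
    ≡⟨ sumℤ-cong (λ j → distrib (M i j) (f 0) (x 0 j) (rest j)) ⟩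
  sumℤ (λ j → f 0 * (M i j * x 0 j) + M i j * rest j)
    ≡⟨ sumℤ-+ (λ j → f 0 * (M i j * x 0 j)) (λ j → M i j * rest j) ⟩
  sumℤ (λ j → f 0 * (M i j * x 0 j)) + matVec M rest i
    ≡⟨ cong₂ _+_ (sumℤ-scale (f 0) (λ j → M i j * x 0 j))
                 (matVec-sumTo M N (f ∘ suc) (x ∘ suc) i) ⟩
  f 0 * matVec M (x 0) i + sumTo N (λ K → f (suc K) * matVec M (x (suc K)) i) ∎
  where
  rest : Fin _ → ℤ
  rest j = sumTo N (λ K → f (suc K) * x (suc K) j)
  distrib : ∀ m f x s → m * (f * x + s) ≡ f * (m * x) + m * s
  distrib = solve-∀

matVec-even : ∀ {n} (M : Matrix n n) v → (∀ j → Even (v j)) → ∀ i → Even (matVec M v i)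
matVec-even M v even i = sumℤ-even _ λ j → ∣.∣n⇒∣m*n (M i j) (even j)

degMat-row : ∀ {n} (G : Graph n) i → sumℤ (degMat G i) ≡ + deg G i
degMat-row G i = trans (sumℤ-single (degMat G i) i off-diagonal) diagonal
  where
  off-diagonal : ∀ j → j ≢ i → degMat G i j ≡ + 0
  off-diagonal j j≢i with i Fin.≟ j
  ... | yes i≡j = ⊥-elim (j≢i (sym i≡j))
  ... | no  _   = refl
  diagonal : degMat G i i ≡ + deg G i
  diagonal with i Fin.≟ i
  ... | yes _   = refl
  ... | no  i≢i = ⊥-elim (i≢i refl)

module Krylov {n} (c′ : ℕ) (a b : ℤ) (G : Graph n) (a+b≡c : a + b ≡ + suc c′) where

  c : ℕ
  c = suc c′

  A : Matrix n n
  A = Ac a b G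

  w : ℕ → Fin n → ℤ
  w k = Wcol c a b G k

  W : Matrix n n
  W = Wtilde c a b G

  A-ones : ∀ i → matVec A ones i ≡ + c * + deg G i
  A-ones i = begin
    sumℤ (λ j → (a * degMat G i j + b * adjMat G i j) * + 1)
      ≡⟨ sumℤ-cong (λ j → ℤ.*-identityʳ (a * degMat G i j + b * adjMat G i j)) ⟩
    sumℤ (λ j → a * degMat G i j + b * adjMat G i j)
      ≡⟨ sumℤ-linear a b (degMat G i) (adjMat G i) ⟩
    a * sumℤ (degMat G i) + b * sumℤ (adjMat G i)
      ≡⟨ cong₂ (λ x y → a * x + b * y) (degMat-row G i) (sumℤ-pos (boolℕ ∘ adj G i)) ⟩
    a * + deg G i + b * + deg G i
      ≡⟨ ℤ.*-distribʳ-+ (+ deg G i) a b ⟨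
    (a + b) * + deg G i
      ≡⟨ cong (_* + deg G i) a+b≡c ⟩
    + c * + deg G i ∎

  private
    exact : ∀ {x y} → x ≡ + c * y → x ≡ + c * divBy x c
    exact x≡cy = trans x≡cy (cong (+ c *_) (sym (divBy-exact c′ x≡cy)))

  A-powers      : ∀ k i → matPowVec A (suc k) ones i ≡ + c * w (suc k) i
  A-powers-step : ∀ k i → matPowVec A (suc (suc k)) ones i ≡ + c * matVec A (w (suc k)) i

  A-powers zero    i = exact (A-ones i)
  A-powers (suc k) i = exact (A-powers-step k i)

  A-powers-step k i = trans (matVec-cong A (A-powers k) i) (matVec-scale A (+ c) (w (suc k)) i)

  A-w-suc : ∀ k i → matVec A (w (suc k)) i ≡ w (suc (suc k)) i
  A-w-suc k i = sym (divBy-exact c′ (A-powers-step k i))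

  combination : ℕ → (ℕ → ℤ) → Fin n → ℤ
  combination N f i = sumTo N (λ K → f K * w K i)

  Mod2Relation : ℕ → (ℕ → ℤ) → Set
  Mod2Relation N f = ∀ i → Even (combination N f i)

  -- The coefficients of A applied to a combination: A w₀ = c w₁ and A wₖ₊₁ = wₖ₊₂.
  shift : (ℕ → ℤ) → ℕ → ℤ
  shift f zero          = + 0
  shift f (suc zero)    = + c * f 0
  shift f (suc (suc K)) = f (suc K)

  combination-shift : ∀ N f i → combination (suc N) (shift f) i ≡ matVec A (combination N f) i
  combination-shift N f i = begin
    + 0 + sumTo N (λ K → shift f (suc K) * w (suc K) i) ≡⟨ ℤ.+-identityˡ _ ⟩
    sumTo N (λ K → shift f (suc K) * w (suc K) i)       ≡⟨ sumTo-cong N (λ K _ → shifted-term K) ⟩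
    sumTo N (λ K → f K * matVec A (w K) i)              ≡⟨ matVec-sumTo A N f w i ⟨
    matVec A (combination N f) i                        ∎
    where
    shifted-term : ∀ K → shift f (suc K) * w (suc K) i ≡ f K * matVec A (w K) i
    shifted-term zero    = begin
      + c * f 0 * w 1 i     ≡⟨ cong (_* w 1 i) (ℤ.*-comm (+ c) (f 0)) ⟩
      f 0 * + c * w 1 i     ≡⟨ ℤ.*-assoc (f 0) (+ c) (w 1 i) ⟩
      f 0 * (+ c * w 1 i)   ≡⟨ cong (f 0 *_) (A-powers 0 i) ⟨
      f 0 * matVec A ones i ∎
    shifted-term (suc K) = cong (f (suc K) *_) (sym (A-w-suc K i))

  shift-relation : ∀ {N f} → Mod2Relation N f → Mod2Relation (suc N) (shift f)
  shift-relation {N} {f} rel i = subst Even (sym (combination-shift N f i)) (matVec-even A _ rel i)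

  record LeadingRelation (N T : ℕ) (f : ℕ → ℤ) : Set where
    field
      relation    : Mod2Relation N f
      leading-one : f T ≡ + 1
      zero-above  : ∀ K → T ℕ.< K → f K ≡ + 0
      T<N         : T ℕ.< N

  shift-leading : ∀ {N T f} → LeadingRelation N (suc T) f →
                  LeadingRelation (suc N) (suc (suc T)) (shift f)
  shift-leading {N} {f = f} l = record
    { relation    = shift-relation {N} {f} relation
    ; leading-one = leading-one
    ; zero-above  = λ { (suc (suc K)) (ℕ.s≤s T+1<K+1) → zero-above (suc K) T+1<K+1 }
    ; T<N         = ℕ.s≤s T<N
    }
    where open LeadingRelation l

  leading⇒dependent : ∀ {N T f} → LeadingRelation N T f → (m : Fin n) → toℕ m ≡ T →
                      DependsMod2OnEarlier W m
  leading⇒dependent {N} {T} {f} l m m≡T = record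
    { half          = half
    ; coefficient   = λ k → restrict T (-_ ∘ f) (toℕ k)
    ; earlier-only  = λ k m≤k → restrict-≥ T _ (toℕ k) (subst (ℕ._≤ toℕ k) m≡T m≤k)
    ; decomposition = decomposition
    }
    where
    open LeadingRelation l
    half : Fin n → ℤ
    half i = _∣_.quotient (relation i)
    lower : Fin n → ℤ
    lower i = sumTo T (λ K → f K * w K i)
    lower+top : ∀ i → lower i + + 1 * w T i ≡ half i * + 2
    lower+top i = begin
      lower i + + 1 * w T i             ≡⟨ cong (λ x → lower i + x * w T i) leading-one ⟨
      lower i + f T * w T i             ≡⟨ sumTo-snoc T (λ K → f K * w K i) ⟨
      sumTo (suc T) (λ K → f K * w K i) ≡⟨ sumTo-vanishing-tail (suc T) _ T<N
                                             (λ K T<K → cong (_* w K i) (zero-above K T<K)) ⟨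
      combination N f i                 ≡⟨ _∣_.equality (relation i) ⟩
      half i * + 2                      ∎
    isolate : ∀ s x h → s + + 1 * x ≡ h * + 2 → x ≡ + 2 * h + - s
    isolate s x h e = trans (isolated s x) (cong (_+ - s) (trans e (ℤ.*-comm h (+ 2))))
      where
      isolated : ∀ s x → x ≡ (s + + 1 * x) + - s
      isolated = solve-∀
    earlier-sum : ∀ i → sumTo n (λ K → restrict T (-_ ∘ f) K * w K i) ≡ - lower i
    earlier-sum i = begin
      sumTo n (λ K → restrict T (-_ ∘ f) K * w K i)
        ≡⟨ sumTo-vanishing-tail T _ (subst (ℕ._≤ n) m≡T (ℕ.<⇒≤ (Fin.toℕ<n m)))
             (λ K T≤K → cong (_* w K i) (restrict-≥ T _ K T≤K)) ⟩
      sumTo T (λ K → restrict T (-_ ∘ f) K * w K i)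
        ≡⟨ sumTo-cong T (λ K K<T → trans (cong (_* w K i) (restrict-< T _ K K<T))
                                         (sym (ℤ.neg-distribˡ-* (f K) (w K i)))) ⟩
      sumTo T (λ K → - (f K * w K i))
        ≡⟨ sumℤ-neg {T} (λ k → f (toℕ k) * w (toℕ k) i) ⟩
      - lower i ∎
    decomposition : ∀ i → W i m ≡ + 2 * half i + sumℤ (λ k → restrict T (-_ ∘ f) (toℕ k) * W i k)
    decomposition i = begin
      w (toℕ m) i                                                  ≡⟨ cong (λ K → w K i) m≡T ⟩
      w T i                                                        ≡⟨ isolate (lower i) (w T i) (half i)
                                                                                (lower+top i) ⟩
      + 2 * half i + - lower i                                     ≡⟨ cong (_+_ (+ 2 * half i)) (earlier-sum i) ⟨
      + 2 * half i + sumTo n (λ K → restrict T (-_ ∘ f) K * w K i) ∎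

  leading-propagates : ∀ s {N T f} → LeadingRelation N (suc T) f →
                       (m : Fin n) → toℕ m ≡ s ℕ.+ suc T → DependsMod2OnEarlier W m
  leading-propagates zero    l m m≡T+1 = leading⇒dependent l m m≡T+1
  leading-propagates (suc s) {T = T} l m m≡s+T+2 =
    leading-propagates s (shift-leading l) m (trans m≡s+T+2 (sym (ℕ.+-suc s (suc T))))

  no-leading-at-zero : ∀ {N f} → LeadingRelation N 0 f → ¬ Fin n
  no-leading-at-zero {N} {f} l i = ¬Even1 (subst Even combination≡1 (relation i))
    where
    open LeadingRelation l
    combination≡1 : combination N f i ≡ + 1
    combination≡1 = begin
      combination N f i ≡⟨ sumTo-vanishing-tail 1 _ T<N (λ K 0<K → cong (_* w K i) (zero-above K 0<K)) ⟩
      f 0 * + 1 + + 0   ≡⟨ cong (λ x → x * + 1 + + 0) leading-one ⟩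
      + 1               ∎

  det-divisible : ∀ {N T f} → LeadingRelation N T f → + (2 ℕ.^ (n ℕ.∸ T)) ∣ det W
  det-divisible {T = zero} l with n ℕ.≟ 0
  ... | yes n≡0 = subst (λ k → + (2 ℕ.^ k) ∣ det W) (sym n≡0) (1∣ (det W))
  ... | no  n≢0 = ⊥-elim (no-leading-at-zero l (Fin.fromℕ< (ℕ.n≢0⇒n>0 n≢0)))
  det-divisible {T = suc T} l = 2^∣det-from (suc T) W λ m T<m →
    leading-propagates (toℕ m ℕ.∸ suc T) l m (sym (ℕ.m∸n+n≡m T<m))

  normalise-leading : ∀ {N T f} → Mod2Relation N f → T ℕ.< N →
                      ¬ Even (f T) → (∀ K → T ℕ.< K → Even (f K)) → LeadingRelation N T (normalise T f)
  normalise-leading {N} {T} {f} rel T<N odd even-above = record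
    { relation    = relation
    ; leading-one = normalise-≡ T f
    ; zero-above  = normalise-> T f
    ; T<N         = T<N
    }
    where
    difference : ℕ → ℤ
    difference K = f K - normalise T f K
    split : ∀ i → combination N difference i + combination N (normalise T f) i ≡ combination N f i
    split i = trans (sym (sumℤ-+ {N} _ _)) (sumTo-cong N λ K _ → recombine (f K) (normalise T f K) (w K i))
      where
      recombine : ∀ x y v → (x - y) * v + y * v ≡ x * v
      recombine = solve-∀
    difference-even : ∀ i → Even (combination N difference i)
    difference-even i = sumℤ-even {N} (λ k → difference (toℕ k) * w (toℕ k) i) λ k →
      ∣.∣m⇒∣m*n (w (toℕ k) i) (normalise-even-difference T f odd even-above (toℕ k))
    relation : Mod2Relation N (normalise T f)
    relation i = ∣.∣m+n∣m⇒∣n (subst Even (sym (split i)) (rel i)) (difference-even i)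

  WindowRelation : ∀ {h} → ℕ → (Fin h → ℤ) → Set
  WindowRelation E coef = ∀ i → Even (sumℤ (λ j → coef j * w (E ℕ.+ toℕ j) i))

  module _ {h} (E : ℕ) (coef : Fin h → ℤ) (rel : WindowRelation E coef) where

    padded-relation : Mod2Relation (E ℕ.+ h) (padLeft E (extend coef))
    padded-relation i = subst Even (sym padded≡window) (rel i)
      where
      padded≡window : combination (E ℕ.+ h) (padLeft E (extend coef)) i
                      ≡ sumℤ (λ j → coef j * w (E ℕ.+ toℕ j) i)
      padded≡window = trans (sumTo-padLeft E h (extend coef) (λ K → w K i))
                            (sumℤ-cong λ j → cong (_* w (E ℕ.+ toℕ j) i) (extend-toℕ coef j))

    odd-coefficient⇒leading : ∀ j → ¬ Even (coef j) →
      ∃ λ t → t ℕ.< h × LeadingRelation (E ℕ.+ h) (E ℕ.+ t) (normalise (E ℕ.+ t) (padLeft E (extend coef)))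
    odd-coefficient⇒leading j odd = t , t<h ,
      normalise-leading padded-relation (ℕ.+-monoʳ-< E t<h) odd-at-top even-above-top
      where
      C = extend coef
      Odd? : Decidable (¬_ ∘ Even ∘ C)
      Odd? K = ¬? (+ 2 ∣.∣? C K)
      last = last-satisfying (¬_ ∘ Even ∘ C) Odd? (Fin.toℕ<n j) (odd ∘ subst Even (extend-toℕ coef j))
      t = proj₁ last
      t<h = proj₁ (proj₂ last)
      padLeft-+ : ∀ K → padLeft E C (E ℕ.+ K) ≡ C K
      padLeft-+ K = trans (padLeft-≥ E C (E ℕ.+ K) (ℕ.m≤m+n E K)) (cong C (ℕ.m+n∸m≡n E K))
      odd-at-top : ¬ Even (padLeft E C (E ℕ.+ t))
      odd-at-top = subst (¬_ ∘ Even) (sym (padLeft-+ t)) (proj₁ (proj₂ (proj₂ last)))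
      even-after-t : ∀ K → t ℕ.< K → Even (C K)
      even-after-t K t<K with K ℕ.<? h
      ... | yes K<h = decidable-stable (+ 2 ∣.∣? C K) (proj₂ (proj₂ (proj₂ last)) K t<K K<h)
      ... | no  K≮h = subst Even (sym (extend-≥ coef K (ℕ.≮⇒≥ K≮h))) Even-0
      even-above-top : ∀ K → E ℕ.+ t ℕ.< K → Even (padLeft E C K)
      even-above-top K E+t<K = subst Even (sym (padLeft-≥ E C K E≤K)) (even-after-t (K ℕ.∸ E) t<K∸E)
        where
        E≤K : E ℕ.≤ K
        E≤K = ℕ.≤-trans (ℕ.m≤m+n E t) (ℕ.<⇒≤ E+t<K)
        t<K∸E : t ℕ.< K ℕ.∸ E
        t<K∸E = subst (ℕ._< K ℕ.∸ E) (ℕ.m+n∸m≡n E t) (ℕ.∸-monoˡ-< E+t<K (ℕ.m≤m+n E t))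

  window-independent : ∀ {h} E → n ≡ E ℕ.+ 2 ℕ.* h →
                       ∀ q → det W ≡ + (2 ℕ.^ h) * q → ¬ Even q →
                       (coef : Fin h → ℤ) → WindowRelation E coef → ∀ j → Even (coef j)
  window-independent {h} E n≡E+2h q det≡2^h*q q-odd coef rel j with + 2 ∣.∣? coef j
  ... | yes even = even
  ... | no  odd  with odd-coefficient⇒leading E coef rel j odd
  ...   | t , t<h , leading = ⊥-elim (q-odd (2^[1+h]∣2^h*q⇒Even h q 2^[1+h]∣2^h*q))
    where
    2^[1+h]∣2^h*q : + (2 ℕ.^ suc h) ∣ + (2 ℕ.^ h) * q
    2^[1+h]∣2^h*q = subst (+ (2 ℕ.^ suc h) ∣_) det≡2^h*q
      (∣.∣-trans (2^-mono-∣ (1+h≤n∸[E+t] E n≡E+2h t<h)) (det-divisible leading))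

↥[z/1]≡z : ∀ z → ↥ (z /ℚ 1) ≡ z
↥[z/1]≡z z =
  trans (sym (ℤ.*-identityʳ _)) (trans (cong (↥ (z /ℚ 1) *_) (sym (ℤ.gcd-zeroʳ z))) (ℚ.↥-/ z 1))

↧[z/1]≡1 : ∀ z → ↧ (z /ℚ 1) ≡ + 1
↧[z/1]≡1 z =
  trans (sym (ℤ.*-identityʳ _)) (trans (cong (↧ (z /ℚ 1) *_) (sym (ℤ.gcd-zeroʳ z))) (ℚ.↧-/ z 1))

↥[a/1+b/1]≡a+b : ∀ a b → ↥ (a /ℚ 1 +ℚ b /ℚ 1) ≡ a + b
↥[a/1+b/1]≡a+b a b = begin
  ↥ (p +ℚ q)                                            ≡⟨ ℤ.*-identityʳ _ ⟨
  ↥ (p +ℚ q) * + 1                                      ≡⟨ cong (↥ (p +ℚ q) *_) gcd≡1 ⟨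
  ↥ (p +ℚ q) * ℤ.gcd (↥ p * ↧ q + ↥ q * ↧ p) (↧ p * ↧ q) ≡⟨ ℚ.↥-+ p q ⟩
  ↥ p * ↧ q + ↥ q * ↧ p                                 ≡⟨ numerator ⟩
  a + b                                                 ∎
  where
  p = a /ℚ 1
  q = b /ℚ 1
  numerator : ↥ p * ↧ q + ↥ q * ↧ p ≡ a + b
  numerator = cong₂ _+_ (trans (cong₂ _*_ (↥[z/1]≡z a) (↧[z/1]≡1 b)) (ℤ.*-identityʳ a))
                        (trans (cong₂ _*_ (↥[z/1]≡z b) (↧[z/1]≡1 a)) (ℤ.*-identityʳ b))
  gcd≡1 : ℤ.gcd (↥ p * ↧ q + ↥ q * ↧ p) (↧ p * ↧ q) ≡ + 1
  gcd≡1 = trans (cong₂ ℤ.gcd numerator (cong₂ _*_ (↧[z/1]≡1 a) (↧[z/1]≡1 b))) (ℤ.gcd-zeroʳ (a + b))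

cα+c[1-α]≡c : ∀ (α : ℚ) c a b → (+ c /ℚ 1) *ℚ α ≡ a /ℚ 1 → (+ c /ℚ 1) *ℚ (1ℚ -ℚ α) ≡ b /ℚ 1 →
              a + b ≡ + c
cα+c[1-α]≡c α c a b cα≡a c[1-α]≡b = begin
  a + b                                          ≡⟨ ↥[a/1+b/1]≡a+b a b ⟨
  ↥ (a /ℚ 1 +ℚ b /ℚ 1)                           ≡⟨ cong₂ (λ x y → ↥ (x +ℚ y)) cα≡a c[1-α]≡b ⟨
  ↥ ((+ c /ℚ 1) *ℚ α +ℚ (+ c /ℚ 1) *ℚ (1ℚ -ℚ α)) ≡⟨ cong ↥_ (distribute (+ c /ℚ 1) α) ⟩
  ↥ (+ c /ℚ 1)                                   ≡⟨ ↥[z/1]≡z (+ c) ⟩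
  + c                                            ∎
  where
  open ℚ-Solver
  distribute : ∀ C α → C *ℚ α +ℚ C *ℚ (1ℚ -ℚ α) ≡ C
  distribute = solve 2 (λ C α → C :* α :+ C :* (con 1ℚ :- α) := C) refl

oddBit : ℕ → ℕ
oddBit n = if isEven n then 0 else 1

n%2≡oddBit : ∀ n → n ℕ.% 2 ≡ oddBit n
n%2≡oddBit zero          = refl
n%2≡oddBit (suc zero)    = refl
n%2≡oddBit (suc (suc n)) =
  trans (trans (cong (ℕ._% 2) (ℕ.+-comm 2 n)) (ℕ.[m+n]%n≡m%n n 2)) (n%2≡oddBit n)

n≡oddBit+2[n/2] : ∀ n → n ≡ oddBit n ℕ.+ 2 ℕ.* (n / 2)
n≡oddBit+2[n/2] n = trans (ℕ.m≡m%n+[m/n]*n n 2) (cong₂ ℕ._+_ (n%2≡oddBit n) (ℕ.*-comm (n / 2) 2))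

Whatt-column : ∀ {n} c a b (G : Graph n) i j → Whatt c a b G i j ≡ Wcol c a b G (oddBit n ℕ.+ toℕ j) i
Whatt-column {n} c a b G i j = by-parity (isEven n)
  where
  by-parity : ∀ e → (if e then Wcol c a b G (toℕ j) i else Wcol c a b G (suc (toℕ j)) i)
                    ≡ Wcol c a b G ((if e then 0 else 1) ℕ.+ toℕ j) i
  by-parity true  = refl
  by-parity false = refl

lemma3p9 : (α : ℚ) → InUnit α → (c : ℕ) → IsCAlpha α c →
    (a b : ℤ) → ((+ c /ℚ 1) *ℚ α ≡ a /ℚ 1) → ((+ c /ℚ 1) *ℚ (1ℚ -ℚ α) ≡ b /ℚ 1) →
    (n : ℕ) (G : Graph n) → Connected G → InF c a b G →
    HasRank 2 (Whatt c a b G) (n / 2)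
lemma3p9 α _ zero     (() , _)
lemma3p9 α _ (suc c′) _ a b cα≡a c[1-α]≡b n G _ ((q , det≡2^h*q , q-odd , _) , _) =
  (id , id , independent) , λ σ σ-injective _ → Fin.<⇒notInjective (ℕ.n<1+n (n / 2)) σ-injective
  where
  open Krylov c′ a b G (cα+c[1-α]≡c α (suc c′) a b cα≡a c[1-α]≡b)
  window : ∀ (coef : Fin (n / 2) → ℤ) i →
           sumℤ (λ j → coef j * Whatt (suc c′) a b G i j) ≡ sumℤ (λ j → coef j * w (oddBit n ℕ.+ toℕ j) i)
  window coef i = sumℤ-cong λ j → cong (coef j *_) (Whatt-column (suc c′) a b G i j)
  independent : IndepCols 2 (Whatt (suc c′) a b G) id
  independent coef rel = ∣.∣⇒∣ᵤ ∘
    window-independent (oddBit n) (n≡oddBit+2[n/2] n) q det≡2^h*q (q-odd ∘ ∣.∣⇒∣ᵤ) coef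
      λ i → subst Even (window coef i) (∣.∣ᵤ⇒∣ (rel i))
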